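{- The class P-compressible$'$ is closed under join: if $A, B\subseteq\Sigma^*$ are each either finite or P-compressible, then $A\oplus B$ is either finite or P-compressible.
   Context: $\Sigma=\{0,1\}$. A function $f$ is a compression function for $A\subseteq\Sigma^*$ if $\mathrm{domain}(f)\supseteq A$, $f(A)=\Sigma^*$, and $f(a)\neq f(b)$ for all distinct $a,b\in A$. $A$ is P-compressible if some total polynomial-time computable function $f:\Sigma^*\to\Sigma^*$ is a compression function for $A$. P-compressible$'$ is the class of sets that are P-compressible together with all finite subsets of $\Sigma^*$. The join is $A\oplus B=\{x0\mid x\in A\}\cup\{x1\mid x\in B\}$. -}

module Defs where

open import Data.Nat using (ℕ; zero; suc; _+_; _*_; _^_; _≤_)
open import Data.Bool using (Bool; true; false)
open import Data.List using (List; []; _∷_; length)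
open import Data.List.Membership.Propositional using (_∈_)
open import Data.Fin using (Fin)
open import Data.Maybe using (Maybe; just; nothing)
open import Data.Product using (Σ; _×_; _,_; ∃; ∃-syntax)
open import Data.Sum using (_⊎_)
open import Function.Bundles using (_⇔_)
open import Relation.Binary.PropositionalEquality using (_≡_; _≢_)

Str : Set
Str = List Bool

Lang : Set₁
Lang = Str → Set

data Sym : Set where
  s0 s1 blank : Sym

data Move : Set where
  L R : Move

record TM : Set where
  field
    nStates : ℕ
    start   : Fin nStates
    -- nothing = halt
    δ       : Fin nStates → Sym → Maybe (Fin nStates × Sym × Move)

-- configuration: state, tape left of head (nearest first), head symbol,
-- tape right of head; unlisted cells are blank (two-way infinite tape)
record Config (M : TM) : Set where
  constructor cfg
  field
    state : Fin (TM.nStates M)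
    left  : List Sym
    head  : Sym
    right : List Sym

bit : Bool → Sym
bit false = s0
bit true  = s1

encode : Str → List Sym
encode []       = []
encode (b ∷ bs) = bit b ∷ encode bs

initial : (M : TM) → Str → Config M
initial M []       = cfg (TM.start M) [] blank []
initial M (b ∷ bs) = cfg (TM.start M) [] (bit b) (encode bs)

-- output: maximal blank-free string starting at the head position
readOut : List Sym → Str
readOut []            = []
readOut (s0 ∷ ss)     = false ∷ readOut ss
readOut (s1 ∷ ss)     = true ∷ readOut ss
readOut (blank ∷ ss)  = []

move : {M : TM} → Fin (TM.nStates M) → List Sym → Sym → List Sym → Move → Config M
move q []       s r L = cfg q [] blank (s ∷ r)
move q (x ∷ l)  s r L = cfg q l x (s ∷ r)
move q l        s [] R = cfg q (s ∷ l) blank []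
move q l        s (x ∷ r) R = cfg q (s ∷ l) x r

step : (M : TM) → Config M → Maybe (Config M)
step M (cfg q l h r) with TM.δ M q h
... | nothing            = nothing
... | just (q' , w , d)  = just (move {M} q' l w r d)

-- run with at most t steps; returns the output if the machine halts
-- after at most t steps
exec : (M : TM) → ℕ → Config M → Maybe Str
exec M t c with step M c
exec M t       (cfg q l h r) | nothing = just (readOut (h ∷ r))
exec M zero    c             | just c' = nothing
exec M (suc t) c             | just c' = exec M t c'

ComputesInTime : TM → (Str → Str) → (ℕ → ℕ) → Set
ComputesInTime M f T =
  ∀ x → ∃[ t ] (t ≤ T (length x) × exec M t (initial M x) ≡ just (f x))

PolyTime : (Str → Str) → Set
PolyTime f = ∃[ M ] ∃[ c ] ∃[ k ] ComputesInTime M f (λ n → c * n ^ k + c)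

IsCompressionFunction : (Str → Str) → Lang → Set
IsCompressionFunction f A =
  (∀ y → ∃[ x ] (A x × f x ≡ y)) ×
  (∀ a b → A a → A b → a ≢ b → f a ≢ f b)

PCompressible : Lang → Set
PCompressible A = ∃[ f ] (PolyTime f × IsCompressionFunction f A)

Finite : Lang → Set
Finite A = ∃[ l ] (∀ x → A x ⇔ x ∈ l)

PCompressible′ : Lang → Set
PCompressible′ A = Finite A ⊎ PCompressible A

-- join A ⊕ B = {x0 | x ∈ A} ∪ {x1 | x ∈ B}  (0 = false, 1 = true, appended at the end)
data _⊕_ (A B : Lang) : Lang where
  inl : ∀ {x} → A x → (A ⊕ B) (x Data.List.++ (false ∷ []))
  inr : ∀ {x} → B x → (A ⊕ B) (x Data.List.++ (true ∷ []))

module Submission where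

-- A join A ⊕ B is compressed by x0 ↦ hA x, x1 ↦ hB x as soon as hA and hB are injective on A and B
-- and their images are disjoint and cover Σ*. If fA and fB compress A and B, take hA = tag₀ ∘ fA and
-- hB = 1·fB, where tag₀ is a bijection of Σ* onto {ε} ∪ 0Σ*. If instead B = {b₀, …, b_{K-1}} is finite,
-- take hB bᵢ = 0^i and hA = shift_K ∘ fA, where shift_K is a bijection of Σ* onto the words other than
-- 0^0, …, 0^{K-1}. Polynomial-time computability is shown with explicit machines: one runs the machine
-- for fA (or fB) and recodes its output in place, one finds the position of a word in a fixed list by
-- reading its code with finitely many states, and one dispatches on the last input bit.

open import Defs

open import Data.Bool using (Bool; true; false; if_then_else_)
import Data.Bool
open import Data.Empty using (⊥-elim)
open import Data.Fin using (Fin; zero; suc; toℕ; fromℕ<; join; splitAt)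
open import Data.Fin.Properties using (splitAt-join; toℕ-fromℕ<)
open import Data.List
  using (List; []; _∷_; length; _++_; [_]; _ʳ++_; _∷ʳ_; foldl; map; replicate; fromMaybe; deduplicate; _∷ʳ′_; initLast)
open import Data.List.Properties
  using (length-++; ++-assoc; ++-identityʳ; ++-ʳ++; length-replicate; reverse-injective; ∷-injectiveʳ; ≡-dec)
open import Data.List.Membership.Propositional using (_∈_)
open import Data.List.Membership.Propositional.Properties
  using (∈-map⁺; ∈-map⁻; ∈-++⁺ˡ; ∈-++⁺ʳ; ∈-++⁻; ∈-deduplicate⁺; ∈-deduplicate⁻)
open import Data.List.Relation.Unary.Any using (here; there)
import Data.List.Relation.Unary.All as All
open import Data.List.Reverse using (Reverse; []; _∶_∶ʳ_; reverseView)
open import Data.List.Relation.Unary.Unique.Propositional using (Unique; []; _∷_)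
open import Data.List.Relation.Unary.Unique.DecPropositional.Properties (≡-dec Data.Bool._≟_) using (deduplicate-!)
open import Data.Maybe using (Maybe; just; nothing; _>>=_)
import Data.Maybe as Maybe
open import Data.Nat using (ℕ; zero; suc; _+_; _*_; _^_; _∸_; _⊔_; _≤_; _<_; _<?_; _≟_; z≤n; s≤s; >-nonZero)
open import Data.Nat.Binary using (ℕᵇ; 2[1+_]; 1+[2_]) renaming (zero to zeroᵇ; toℕ to toℕᵇ)
open import Data.Nat.Binary.Properties
  using (2[1+_]-injective; 1+[2_]-injective) renaming (toℕ-injective to toℕᵇ-injective)
open import Data.Nat.Properties
open import Data.Nat.Tactic.RingSolver using (solve-∀)
open import Data.Product using (Σ; _×_; _,_; ∃-syntax; proj₁; proj₂)
import Data.Product as Product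
open import Data.Sum using (_⊎_; inj₁; inj₂)
import Data.Sum as Sum
open import Data.Unit using (⊤; tt)
open import Function.Base using (case_of_)
open import Function.Bundles using (_⇔_; mk⇔; Equivalence)
open import Relation.Binary.PropositionalEquality hiding ([_])
open import Relation.Nullary using (yes; no)

hd : List Sym → Sym
hd []      = blank
hd (x ∷ _) = x

tl : List Sym → List Sym
tl []      = []
tl (_ ∷ r) = r

conf : {M : TM} → Fin (TM.nStates M) → List Sym → List Sym → Config M
conf q l r = cfg q l (hd r) (tl r)

move-R : ∀ {M} q l s r → move {M} q l s r R ≡ conf {M} q (s ∷ l) r
move-R q []      s []      = refl
move-R q []      s (x ∷ r) = refl
move-R q (_ ∷ _) s []      = refl
move-R q (_ ∷ _) s (x ∷ r) = refl

move-L : ∀ {M} q l s r → move {M} q l s r L ≡ conf {M} q (tl l) (hd l ∷ s ∷ r)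
move-L q []      s r = refl
move-L q (x ∷ l) s r = refl

initial≡conf : ∀ M x → initial M x ≡ conf {M} (TM.start M) [] (encode x)
initial≡conf M []      = refl
initial≡conf M (b ∷ x) = refl

steps : (M : TM) → ℕ → Config M → Maybe (Config M)
steps M zero    c = just c
steps M (suc n) c = step M c >>= steps M n

output : ∀ {M} → Config M → Str
output (cfg q l h r) = readOut (h ∷ r)

step-δ-just : ∀ M q l h r q' w d → TM.δ M q h ≡ just (q' , w , d) →
              step M (cfg q l h r) ≡ just (move {M} q' l w r d)
step-δ-just M q l h r q' w d eq with TM.δ M q h
step-δ-just M q l h r q' w d refl | just _ = refl

step-δ-nothing : ∀ M q l h r → TM.δ M q h ≡ nothing → step M (cfg q l h r) ≡ nothing
step-δ-nothing M q l h r eq with TM.δ M q h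
step-δ-nothing M q l h r refl | nothing = refl

halted⇒δ-nothing : ∀ M q l h r → step M (cfg q l h r) ≡ nothing → TM.δ M q h ≡ nothing
halted⇒δ-nothing M q l h r e with TM.δ M q h
halted⇒δ-nothing M q l h r e  | nothing = refl
halted⇒δ-nothing M q l h r () | just _

exec-halted : ∀ M t c → step M c ≡ nothing → exec M t c ≡ just (output c)
exec-halted M t (cfg q l h r) eq with step M (cfg q l h r)
exec-halted M t (cfg q l h r) eq | nothing = refl
exec-halted M t (cfg q l h r) () | just _

exec-step : ∀ M t c c' → step M c ≡ just c' → exec M (suc t) c ≡ exec M t c'
exec-step M t (cfg q l h r) c' eq with step M (cfg q l h r)
exec-step M t (cfg q l h r) c' refl | just _ = refl

steps-+ : ∀ M m n {c c₁ c₂} → steps M m c ≡ just c₁ → steps M n c₁ ≡ just c₂ → steps M (m + n) c ≡ just c₂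
steps-+ M zero    n refl e₂ = e₂
steps-+ M (suc m) n {c} e₁ e₂ with step M c
... | just c' = steps-+ M m n e₁ e₂

steps-step : ∀ M {c c₂} c₁ n → step M c ≡ just c₁ → steps M n c₁ ≡ just c₂ → steps M (suc n) c ≡ just c₂
steps-step M c₁ n e₁ e₂ rewrite e₁ = e₂

steps-suc⁻ : ∀ M n {c c'} → steps M (suc n) c ≡ just c' →
             Σ (Config M) λ c₁ → step M c ≡ just c₁ × steps M n c₁ ≡ just c'
steps-suc⁻ M n {c} e with step M c
... | just c₁ = c₁ , refl , e

record Run (M : TM) (t : ℕ) (c : Config M) (y : Str) : Set where
  constructor run
  field
    n      : ℕ
    n≤t    : n ≤ t
    final  : Config M
    reach  : steps M n c ≡ just final
    halted : step M final ≡ nothing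
    out≡y  : output final ≡ y

exec⇒Run : ∀ M t c {y} → exec M t c ≡ just y → Run M t c y
exec⇒Run M t (cfg q l h r) e with step M (cfg q l h r) in eq
exec⇒Run M t       (cfg q l h r) refl | nothing = run zero z≤n _ refl eq refl
exec⇒Run M zero    (cfg q l h r) ()   | just c₁
exec⇒Run M (suc t) (cfg q l h r) e    | just c₁ with exec⇒Run M t c₁ e
... | run n le f reach halted out = run (suc n) (s≤s le) f (steps-step M c₁ n eq reach) halted out

Run⇒exec : ∀ M {t c y} → Run M t c y → exec M t c ≡ just y
Run⇒exec M (run n le f reach halted refl) = go n le reach
  where
  go : ∀ n {t c} → n ≤ t → steps M n c ≡ just f → exec M t c ≡ just (output f)
  go zero    _         refl = exec-halted M _ f halted
  go (suc n) {c = c} (s≤s le) e with steps-suc⁻ M n e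
  ... | c₁ , e₁ , e₂ = trans (exec-step M _ c c₁ e₁) (go n le e₂)

Run-weaken : ∀ {M t t' c y} → t ≤ t' → Run M t c y → Run M t' c y
Run-weaken le (run n l f r h o) = run n (≤-trans l le) f r h o

Run-prefix : ∀ M m {t c c₁ y} → steps M m c ≡ just c₁ → Run M t c₁ y → Run M (m + t) c y
Run-prefix M m e (run n le f r h o) = run (m + n) (+-monoʳ-≤ m le) f (steps-+ M m n e r) h o

Run-step : ∀ M {t c c₁ y} → step M c ≡ just c₁ → Run M t c₁ y → Run M (suc t) c y
Run-step M e (run n le f r h o) = run (suc n) (s≤s le) f (steps-step M _ n e r) h o

Run-halt : ∀ M {c y} → step M c ≡ nothing → output c ≡ y → Run M 0 c y
Run-halt M h o = run 0 z≤n _ refl h o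

-- Tapes that differ only by trailing blanks

infix 4 _~_ _≅_

data _~_ : List Sym → List Sym → Set where
  nil  : [] ~ []
  bl-r : ∀ {l} → [] ~ l → [] ~ (blank ∷ l)
  bl-l : ∀ {l} → l ~ [] → (blank ∷ l) ~ []
  cons : ∀ x {l l'} → l ~ l' → (x ∷ l) ~ (x ∷ l')

~-refl : ∀ l → l ~ l
~-refl []      = nil
~-refl (x ∷ l) = cons x (~-refl l)

~-sym : ∀ {l l'} → l ~ l' → l' ~ l
~-sym nil        = nil
~-sym (bl-r p)   = bl-l (~-sym p)
~-sym (bl-l p)   = bl-r (~-sym p)
~-sym (cons x p) = cons x (~-sym p)

++-blanks~ : ∀ l → (l ++ blank ∷ blank ∷ []) ~ l
++-blanks~ []      = bl-l (bl-l nil)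
++-blanks~ (x ∷ l) = cons x (++-blanks~ l)

++-blank~ : ∀ l → (l ++ blank ∷ []) ~ l
++-blank~ []      = bl-l nil
++-blank~ (x ∷ l) = cons x (++-blank~ l)

hd-~ : ∀ {l l'} → l ~ l' → hd l ≡ hd l'
hd-~ nil        = refl
hd-~ (bl-r _)   = refl
hd-~ (bl-l _)   = refl
hd-~ (cons x _) = refl

tl-~ : ∀ {l l'} → l ~ l' → tl l ~ tl l'
tl-~ nil        = nil
tl-~ (bl-r p)   = p
tl-~ (bl-l p)   = p
tl-~ (cons x p) = p

readOut-~ : ∀ {l l'} → l ~ l' → readOut l ≡ readOut l'
readOut-~ nil            = refl
readOut-~ (bl-r _)       = refl
readOut-~ (bl-l _)       = refl
readOut-~ (cons s0 p)    = cong (false ∷_) (readOut-~ p)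
readOut-~ (cons s1 p)    = cong (true ∷_) (readOut-~ p)
readOut-~ (cons blank p) = refl

readOut-shape : ∀ u → Σ (List Sym) λ t → u ~ encode (readOut u) ++ blank ∷ t
readOut-shape []          = [] , bl-r nil
readOut-shape (blank ∷ u) = u , ~-refl _
readOut-shape (s0 ∷ u)    = let t , p = readOut-shape u in t , cons s0 p
readOut-shape (s1 ∷ u)    = let t , p = readOut-shape u in t , cons s1 p

data _≅_ {M : TM} : Config M → Config M → Set where
  ceq : ∀ {q l l' h r r'} → l ~ l' → r ~ r' → cfg q l h r ≅ cfg q l' h r'

conf-≅ : ∀ {M} q {l l' r r'} → l ~ l' → r ~ r' → conf {M} q l r ≅ conf q l' r'
conf-≅ q {r = r} {r'} p e rewrite hd-~ e = ceq p (tl-~ e)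

move-≅ : ∀ {M} q {l l' r r'} s d → l ~ l' → r ~ r' → move {M} q l s r d ≅ move q l' s r' d
move-≅ {M} q {l} {l'} {r} {r'} s R p e rewrite move-R {M} q l s r | move-R {M} q l' s r' =
  conf-≅ q (cons s p) e
move-≅ {M} q {l} {l'} {r} {r'} s L p e rewrite move-L {M} q l s r | move-L {M} q l' s r' | hd-~ p =
  conf-≅ q (tl-~ p) (cons _ (cons s e))

data StepRel {M : TM} : Maybe (Config M) → Maybe (Config M) → Set where
  both-halt : StepRel nothing nothing
  both-move : ∀ {d d'} → d ≅ d' → StepRel (just d) (just d')

step-≅ : ∀ M {c c'} → c ≅ c' → StepRel (step M c) (step M c')
step-≅ M (ceq {q} {h = h} p e) with TM.δ M q h
... | nothing          = both-halt
... | just (q' , w , d) = both-move (move-≅ q' w d p e)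

steps-≅ : ∀ M n {c c' d} → c ≅ c' → steps M n c ≡ just d → Σ (Config M) λ d' → steps M n c' ≡ just d' × d ≅ d'
steps-≅ M zero    p refl = _ , refl , p
steps-≅ M (suc n) {c} {c'} p e with step M c | step M c' | step-≅ M p
... | just d₁ | just d₁' | both-move p₁ = steps-≅ M n p₁ e

halted-≅ : ∀ M {c c'} → c ≅ c' → step M c ≡ nothing → step M c' ≡ nothing
halted-≅ M {c} {c'} p e with step M c | step M c' | step-≅ M p
... | nothing | nothing | both-halt = refl

output-≅ : ∀ {M} {c c' : Config M} → c ≅ c' → output c ≡ output c'
output-≅ (ceq {h = h} p e) = readOut-~ (cons h e)

Run-≅ : ∀ M {t c c' y} → c ≅ c' → Run M t c y → Run M t c' y
Run-≅ M p (run n le f r h o) =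
  let f' , r' , pf = steps-≅ M n p r in run n le f' r' (halted-≅ M pf h) (trans (sym (output-≅ pf)) o)

rlength : ∀ {M} → Config M → ℕ
rlength (cfg q l h r) = length r

length-tl : ∀ r → length (tl r) ≤ length r
length-tl []      = z≤n
length-tl (x ∷ r) = n≤1+n _

length-encode : ∀ x → length (encode x) ≡ length x
length-encode []      = refl
length-encode (b ∷ x) = cong suc (length-encode x)

step-rlength : ∀ M c {c'} → step M c ≡ just c' → rlength c' ≤ suc (rlength c)
step-rlength M (cfg q l h r) e with TM.δ M q h
step-rlength M (cfg q l h r) refl | just (q' , w , R) rewrite move-R {M} q' l w r = ≤-trans (length-tl r) (n≤1+n _)
step-rlength M (cfg q l h r) refl | just (q' , w , L) rewrite move-L {M} q' l w r = ≤-refl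

steps-rlength : ∀ M n c {c'} → steps M n c ≡ just c' → rlength c' ≤ n + rlength c
steps-rlength M zero    c refl = ≤-refl
steps-rlength M (suc n) c {c'} e with steps-suc⁻ M n e
... | c₁ , e₁ , e₂ = begin
  rlength c'          ≤⟨ steps-rlength M n c₁ e₂ ⟩
  n + rlength c₁      ≤⟨ +-monoʳ-≤ n (step-rlength M c e₁) ⟩
  n + suc (rlength c) ≡⟨ +-suc n (rlength c) ⟩
  suc n + rlength c   ∎
  where open ≤-Reasoning

length-readOut : ∀ l → length (readOut l) ≤ length l
length-readOut []          = z≤n
length-readOut (s0 ∷ l)    = s≤s (length-readOut l)
length-readOut (s1 ∷ l)    = s≤s (length-readOut l)
length-readOut (blank ∷ l) = z≤n

Run-output-length : ∀ M {t x y} → Run M t (initial M x) y → length y ≤ suc (t + length x)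
Run-output-length M {t} {x} (run n le (cfg q l h r) reach _ refl) =
  ≤-trans (length-readOut (h ∷ r)) (s≤s (begin
    length r                        ≤⟨ steps-rlength M n _ reach ⟩
    n + rlength (initial M x)       ≤⟨ +-mono-≤ le (initial-rlength x) ⟩
    t + length x                    ∎))
  where
  open ≤-Reasoning
  initial-rlength : ∀ x → rlength (initial M x) ≤ length x
  initial-rlength []      = z≤n
  initial-rlength (b ∷ x) = ≤-trans (≤-reflexive (length-encode x)) (n≤1+n _)

record FinEnum (A : Set) : Set where
  field
    size          : ℕ
    toFin         : A → Fin size
    fromFin       : Fin size → A
    fromFin-toFin : ∀ a → fromFin (toFin a) ≡ a
open FinEnum public

Fin-enum : ∀ n → FinEnum (Fin n)
Fin-enum n = record { size = n ; toFin = λ i → i ; fromFin = λ i → i ; fromFin-toFin = λ _ → refl }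

⊤-enum : FinEnum ⊤
⊤-enum = record { size = 1 ; toFin = λ _ → zero ; fromFin = λ _ → tt ; fromFin-toFin = λ _ → refl }

_⊎-enum_ : ∀ {A B} → FinEnum A → FinEnum B → FinEnum (A ⊎ B)
EA ⊎-enum EB = record
  { size          = size EA + size EB
  ; toFin         = λ s → join _ _ (Sum.map (toFin EA) (toFin EB) s)
  ; fromFin       = λ i → Sum.map (fromFin EA) (fromFin EB) (splitAt _ i)
  ; fromFin-toFin = from-to
  }
  where
  from-to : ∀ s → Sum.map (fromFin EA) (fromFin EB) (splitAt _ (join _ _ (Sum.map (toFin EA) (toFin EB) s))) ≡ s
  from-to (inj₁ a) rewrite splitAt-join (size EA) (size EB) (inj₁ (toFin EA a)) = cong inj₁ (fromFin-toFin EA a)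
  from-to (inj₂ b) rewrite splitAt-join (size EA) (size EB) (inj₂ (toFin EB b)) = cong inj₂ (fromFin-toFin EB b)

Action : Set → Set
Action S = Maybe (S × Sym × Move)

relabel : ∀ {A B : Set} → (A → B) → Action A → Action B
relabel f = Maybe.map (Product.map₁ f)

record FinMachine : Set₁ where
  field
    State : Set
    enum  : FinEnum State
    start : State
    δ     : State → Sym → Action State
open FinMachine public

compile : FinMachine → TM
compile G = record
  { nStates = size (enum G)
  ; start   = toFin (enum G) (start G)
  ; δ       = λ q h → relabel (toFin (enum G)) (δ G (fromFin (enum G) q) h)
  }

module _ (G : FinMachine) where

  gcfg : State G → List Sym → Sym → List Sym → Config (compile G)
  gcfg s = cfg (toFin (enum G) s)

  gconf : State G → List Sym → List Sym → Config (compile G)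
  gconf s = conf {compile G} (toFin (enum G) s)

  compile-δ : ∀ s h → TM.δ (compile G) (toFin (enum G) s) h ≡ relabel (toFin (enum G)) (δ G s h)
  compile-δ s h = cong (λ z → relabel (toFin (enum G)) (δ G z h)) (fromFin-toFin (enum G) s)

  gstep : ∀ s l h r {s' w d} → δ G s h ≡ just (s' , w , d) →
          step (compile G) (gcfg s l h r) ≡ just (move {compile G} (toFin (enum G) s') l w r d)
  gstep s l h r eq = step-δ-just (compile G) _ l h r _ _ _ (trans (compile-δ s h) (cong (relabel _) eq))

  ghalt : ∀ s l h r → δ G s h ≡ nothing → step (compile G) (gcfg s l h r) ≡ nothing
  ghalt s l h r eq = step-δ-nothing (compile G) _ l h r (trans (compile-δ s h) (cong (relabel _) eq))

  gstep-R : ∀ s l h r {s' w} → δ G s h ≡ just (s' , w , R) →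
            step (compile G) (gcfg s l h r) ≡ just (gconf s' (w ∷ l) r)
  gstep-R s l h r eq = trans (gstep s l h r eq) (cong just (move-R {compile G} _ l _ r))

  gstep-L : ∀ s l h r {s' w} → δ G s h ≡ just (s' , w , L) →
            step (compile G) (gcfg s l h r) ≡ just (gconf s' (tl l) (hd l ∷ w ∷ r))
  gstep-L s l h r eq = trans (gstep s l h r eq) (cong just (move-L {compile G} _ l _ r))

  steps-R : ∀ s l h r n {s' w c} → δ G s h ≡ just (s' , w , R) →
            steps (compile G) n (gconf s' (w ∷ l) r) ≡ just c → steps (compile G) (suc n) (gcfg s l h r) ≡ just c
  steps-R s l h r n eq = steps-step (compile G) _ n (gstep-R s l h r eq)

  steps-L : ∀ s l h r n {s' w c} → δ G s h ≡ just (s' , w , L) →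
            steps (compile G) n (gconf s' (tl l) (hd l ∷ w ∷ r)) ≡ just c → steps (compile G) (suc n) (gcfg s l h r) ≡ just c
  steps-L s l h r n eq = steps-step (compile G) _ n (gstep-L s l h r eq)

  Run-R : ∀ s l h r {s' w t y} → δ G s h ≡ just (s' , w , R) →
          Run (compile G) t (gconf s' (w ∷ l) r) y → Run (compile G) (suc t) (gcfg s l h r) y
  Run-R s l h r eq = Run-step (compile G) (gstep-R s l h r eq)

  Run-L : ∀ s l h r {s' w t y} → δ G s h ≡ just (s' , w , L) →
          Run (compile G) t (gconf s' (tl l) (hd l ∷ w ∷ r)) y → Run (compile G) (suc t) (gcfg s l h r) y
  Run-L s l h r eq = Run-step (compile G) (gstep-L s l h r eq)

  gconf-initial : ∀ x → initial (compile G) x ≡ gconf (start G) [] (encode x)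
  gconf-initial = initial≡conf (compile G)

module Simulation (M : TM) (G : FinMachine) (ι : Fin (TM.nStates M) → State G)
  (δ-sim : ∀ {q h q' w d} → TM.δ M q h ≡ just (q' , w , d) → δ G (ι q) h ≡ just (ι q' , w , d)) where

  embed : Config M → Config (compile G)
  embed (cfg q l h r) = gcfg G (ι q) l h r

  embed-move : ∀ q l w r d → embed (move {M} q l w r d) ≡ move {compile G} (toFin (enum G) (ι q)) l w r d
  embed-move q l w r R rewrite move-R {M} q l w r | move-R {compile G} (toFin (enum G) (ι q)) l w r = refl
  embed-move q l w r L rewrite move-L {M} q l w r | move-L {compile G} (toFin (enum G) (ι q)) l w r = refl

  embed-step : ∀ c {c'} → step M c ≡ just c' → step (compile G) (embed c) ≡ just (embed c')
  embed-step (cfg q l h r) e with TM.δ M q h in eq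
  embed-step (cfg q l h r) refl | just (q' , w , d) =
    trans (gstep G (ι q) l h r (δ-sim eq)) (cong just (sym (embed-move q' l w r d)))

  embed-steps : ∀ n c {c'} → steps M n c ≡ just c' → steps (compile G) n (embed c) ≡ just (embed c')
  embed-steps zero    c refl = refl
  embed-steps (suc n) c e with steps-suc⁻ M n e
  ... | c₁ , e₁ , e₂ = steps-step (compile G) (embed c₁) n (embed-step c e₁) (embed-steps n c₁ e₂)

module Embedding (G H : FinMachine) (ι : State G → State H)
  (δ-ι : ∀ s h → δ H (ι s) h ≡ relabel ι (δ G s h)) where

  private
    ι′ : Fin (size (enum G)) → State H
    ι′ q = ι (fromFin (enum G) q)

    δ-sim : ∀ {q h q' w d} → TM.δ (compile G) q h ≡ just (q' , w , d) → δ H (ι′ q) h ≡ just (ι′ q' , w , d)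
    δ-sim {q} {h} e rewrite δ-ι (fromFin (enum G) q) h with δ G (fromFin (enum G) q) h
    δ-sim refl | just (s' , w , d) rewrite fromFin-toFin (enum G) s' = refl

  open Simulation (compile G) H ι′ δ-sim public

  embed-halted : ∀ c → step (compile G) c ≡ nothing → step (compile H) (embed c) ≡ nothing
  embed-halted (cfg q l h r) e with δ G (fromFin (enum G) q) h in eq
  ... | nothing = ghalt H _ l h r (trans (δ-ι _ h) (cong (relabel ι) eq))
  embed-halted (cfg q l h r) () | just _

  embed-gconf : ∀ s l r → embed (gconf G s l r) ≡ gconf H (ι s) l r
  embed-gconf s l r rewrite fromFin-toFin (enum G) s = refl

  embed-Run : ∀ {t c y} → Run (compile G) t c y → Run (compile H) t (embed c) y
  embed-Run {c = c} (run n le f reach halted out) =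
    run n le (embed f) (embed-steps n c reach) (embed-halted f halted) (trans (output-embed f) out)
    where
    output-embed : ∀ f → output (embed f) ≡ output f
    output-embed (cfg q l h r) = refl

zeros : ℕ → Str
zeros n = replicate n false

zeros-+ : ∀ a b → zeros a ++ zeros b ≡ zeros (a + b)
zeros-+ zero    b = refl
zeros-+ (suc a) b = cong (false ∷_) (zeros-+ a b)

zeros-snoc : ∀ n r → encode (zeros n) ++ s0 ∷ r ≡ s0 ∷ encode (zeros n) ++ r
zeros-snoc zero    r = refl
zeros-snoc (suc n) r = cong (s0 ∷_) (zeros-snoc n r)

encode-++ : ∀ x y → encode (x ++ y) ≡ encode x ++ encode y
encode-++ []      y = refl
encode-++ (b ∷ x) y = cong (bit b ∷_) (encode-++ x y)

readOut-encode : ∀ y t → readOut (encode y ++ blank ∷ t) ≡ y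
readOut-encode []          t = refl
readOut-encode (false ∷ y) t = cong (false ∷_) (readOut-encode y t)
readOut-encode (true ∷ y)  t = cong (true ∷_) (readOut-encode y t)

hd∷tl : ∀ u t → hd (encode u ++ blank ∷ t) ∷ tl (encode u ++ blank ∷ t) ≡ encode u ++ blank ∷ t
hd∷tl []      t = refl
hd∷tl (b ∷ u) t = refl

module _ (G : FinMachine) where

  scan-right : ∀ {X : Set} (σ : X → State G) (next : X → Bool → X) →
               (∀ x a → δ G (σ x) (bit a) ≡ just (σ (next x a) , bit a , R)) →
               ∀ x w l r → steps (compile G) (length w) (gconf G (σ x) l (encode w ++ r))
                           ≡ just (gconf G (σ (foldl next x w)) (encode w ʳ++ l) r)
  scan-right σ next δ-σ x []      l r = refl
  scan-right σ next δ-σ x (a ∷ w) l r =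
    steps-R G (σ x) l (bit a) _ (length w) (δ-σ x a) (scan-right σ next δ-σ (next x a) w (bit a ∷ l) r)

  scan-zeros-right : ∀ {s} → δ G s s0 ≡ just (s , s0 , R) → ∀ n l r →
                     steps (compile G) n (gconf G s l (encode (zeros n) ++ r))
                     ≡ just (gconf G s (encode (zeros n) ʳ++ l) r)
  scan-zeros-right δ-s zero    l r = refl
  scan-zeros-right δ-s (suc n) l r =
    steps-R G _ l s0 _ n δ-s (scan-zeros-right δ-s n (s0 ∷ l) r)

  scan-left : ∀ {s} → (∀ a → δ G s (bit a) ≡ just (s , bit a , L)) → ∀ w Γ r → hd Γ ≡ blank →
              steps (compile G) (length w) (gconf G s (tl (encode w ʳ++ Γ)) (hd (encode w ʳ++ Γ) ∷ r))
              ≡ just (gconf G s (tl Γ) (blank ∷ encode w ++ r))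
  scan-left {s} δ-s w Γ r hΓ = go (reverseView w) r
    where
    go : ∀ {w} → Reverse w → ∀ r → steps (compile G) (length w) (gconf G s (tl (encode w ʳ++ Γ)) (hd (encode w ʳ++ Γ) ∷ r))
                                   ≡ just (gconf G s (tl Γ) (blank ∷ encode w ++ r))
    go [] r rewrite hΓ = refl
    go (u ∶ ρ ∶ʳ a) r rewrite encode-++ u [ a ] | ++-ʳ++ (encode u) {[ bit a ]} {Γ} | length-++ u {[ a ]} | +-comm (length u) 1
                            | ++-assoc (encode u) [ bit a ] r =
      steps-L G s (encode u ʳ++ Γ) (bit a) r (length u) (δ-s a) (go ρ (bit a ∷ r))

-- The join machine

dispatch : (Str → Str) → (Str → Str) → Str → Str
dispatch h₀ h₁ w with initLast w
... | []      = []
... | x ∷ʳ′ b = (if b then h₁ else h₀) x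

initLast-∷ʳ : ∀ (x : Str) b → initLast (x ∷ʳ b) ≡ x ∷ʳ′ b
initLast-∷ʳ []      b = refl
initLast-∷ʳ (a ∷ x) b rewrite initLast-∷ʳ x b = refl

dispatch-∷ʳ : ∀ h₀ h₁ x b → dispatch h₀ h₁ (x ∷ʳ b) ≡ (if b then h₁ else h₀) x
dispatch-∷ʳ h₀ h₁ x b rewrite initLast-∷ʳ x b = refl

data JoinPhase : Set where
  scan last : JoinPhase
  rewind    : Bool → JoinPhase

JoinPhase-enum : FinEnum JoinPhase
JoinPhase-enum = record { size = 4 ; toFin = to ; fromFin = from ; fromFin-toFin = from-to }
  where
  to : JoinPhase → Fin 4
  to scan           = zero
  to last           = suc zero
  to (rewind false) = suc (suc zero)
  to (rewind true)  = suc (suc (suc zero))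
  from : Fin 4 → JoinPhase
  from zero                   = scan
  from (suc zero)             = last
  from (suc (suc zero))       = rewind false
  from (suc (suc (suc zero))) = rewind true
  from-to : ∀ p → from (to p) ≡ p
  from-to scan           = refl
  from-to last           = refl
  from-to (rewind false) = refl
  from-to (rewind true)  = refl

-- Scan to the right end, erase the last bit b, rewind, and run G_b on what is left.
module Join (G₀ G₁ : FinMachine) where

  branch : Bool → FinMachine
  branch b = if b then G₁ else G₀

  JState : Set
  JState = JoinPhase ⊎ (State G₀ ⊎ State G₁)

  in₀ : State G₀ → JState
  in₀ s = inj₂ (inj₁ s)

  in₁ : State G₁ → JState
  in₁ s = inj₂ (inj₂ s)

  enter : Bool → JState
  enter false = in₀ (start G₀)
  enter true  = in₁ (start G₁)

  δJ : JState → Sym → Action JState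
  δJ (inj₁ scan)       blank = just (inj₁ last , blank , L)
  δJ (inj₁ scan)       a     = just (inj₁ scan , a , R)
  δJ (inj₁ last)       s0    = just (inj₁ (rewind false) , blank , L)
  δJ (inj₁ last)       s1    = just (inj₁ (rewind true) , blank , L)
  δJ (inj₁ last)       blank = nothing
  δJ (inj₁ (rewind b)) blank = just (enter b , blank , R)
  δJ (inj₁ (rewind b)) a     = just (inj₁ (rewind b) , a , L)
  δJ (inj₂ (inj₁ s))   h     = relabel in₀ (δ G₀ s h)
  δJ (inj₂ (inj₂ s))   h     = relabel in₁ (δ G₁ s h)

  JoinM : FinMachine
  JoinM = record
    { State = JState
    ; enum  = JoinPhase-enum ⊎-enum (enum G₀ ⊎-enum enum G₁)
    ; start = inj₁ scan
    ; δ     = δJ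
    }

  M : TM
  M = compile JoinM

  private
    BB : List Sym
    BB = blank ∷ blank ∷ []

    δ-scan : ∀ (x : ⊤) a → δJ (inj₁ scan) (bit a) ≡ just (inj₁ scan , bit a , R)
    δ-scan _ false = refl
    δ-scan _ true  = refl

    δ-last : ∀ b → δJ (inj₁ last) (bit b) ≡ just (inj₁ (rewind b) , blank , L)
    δ-last false = refl
    δ-last true  = refl

    δ-rewind : ∀ b a → δJ (inj₁ (rewind b)) (bit a) ≡ just (inj₁ (rewind b) , bit a , L)
    δ-rewind b false = refl
    δ-rewind b true  = refl

    scanned : ∀ x b → steps M (length (x ∷ʳ b)) (initial M (x ∷ʳ b))
                      ≡ just (gconf JoinM (inj₁ scan) (bit b ∷ encode x ʳ++ []) [])
    scanned x b = begin
      steps M (length w) (initial M w)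
        ≡⟨ cong (steps M (length w)) (trans (gconf-initial JoinM w)
                                            (cong (gconf JoinM (inj₁ scan) []) (sym (++-identityʳ (encode w))))) ⟩
      steps M (length w) (gconf JoinM (inj₁ scan) [] (encode w ++ []))
        ≡⟨ scan-right JoinM (λ _ → inj₁ scan) (λ _ _ → tt) δ-scan tt w [] [] ⟩
      just (gconf JoinM (inj₁ scan) (encode w ʳ++ []) [])
        ≡⟨ cong (λ z → just (gconf JoinM (inj₁ scan) (z ʳ++ []) [])) (encode-++ x [ b ]) ⟩
      just (gconf JoinM (inj₁ scan) ((encode x ++ [ bit b ]) ʳ++ []) [])
        ≡⟨ cong (λ z → just (gconf JoinM (inj₁ scan) z [])) (++-ʳ++ (encode x)) ⟩
      just (gconf JoinM (inj₁ scan) (bit b ∷ encode x ʳ++ []) []) ∎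
      where
      open ≡-Reasoning
      w = x ∷ʳ b

  prepare : ∀ x b → steps M (length (x ∷ʳ b) + suc (suc (length x + 1))) (initial M (x ∷ʳ b))
                    ≡ just (gconf JoinM (enter b) (blank ∷ []) (encode x ++ BB))
  prepare x b =
    steps-+ M (length (x ∷ʳ b)) (suc (suc (length x + 1))) (scanned x b)
      (steps-L JoinM (inj₁ scan) (bit b ∷ encode x ʳ++ []) blank [] (suc (length x + 1)) refl
      (steps-L JoinM (inj₁ last) (encode x ʳ++ []) (bit b) (blank ∷ []) (length x + 1) (δ-last b)
      (steps-+ M (length x) 1 (scan-left JoinM (δ-rewind b) x [] BB refl)
      (steps-R JoinM (inj₁ (rewind b)) [] blank (encode x ++ BB) 0 (δ-enter b) refl))))
    where
    δ-enter : ∀ b → δJ (inj₁ (rewind b)) blank ≡ just (enter b , blank , R)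
    δ-enter _ = refl

  padded : ∀ G x → initial (compile G) x ≅ gconf G (start G) (blank ∷ []) (encode x ++ BB)
  padded G x rewrite gconf-initial G x = conf-≅ _ (bl-r nil) (~-sym (++-blanks~ (encode x)))

  enter-Run : ∀ b x {t y} → Run (compile (branch b)) t (initial _ x) y →
              Run M t (gconf JoinM (enter b) (blank ∷ []) (encode x ++ BB)) y
  enter-Run false x {t} {y} r =
    subst (λ c → Run M t c y) (E.embed-gconf _ _ (encode x ++ BB)) (E.embed-Run (Run-≅ _ (padded G₀ x) r))
    where module E = Embedding G₀ JoinM in₀ (λ _ _ → refl)
  enter-Run true  x {t} {y} r =
    subst (λ c → Run M t c y) (E.embed-gconf _ _ (encode x ++ BB)) (E.embed-Run (Run-≅ _ (padded G₁ x) r))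
    where module E = Embedding G₁ JoinM in₁ (λ _ _ → refl)

  Run-∷ʳ : ∀ x b {t y} → Run (compile (branch b)) t (initial _ x) y →
           Run M (length (x ∷ʳ b) + suc (suc (length x + 1)) + t) (initial M (x ∷ʳ b)) y
  Run-∷ʳ x b r = Run-prefix M _ (prepare x b) (enter-Run b x r)

  Run-[] : Run M 1 (initial M []) []
  Run-[] = run 1 ≤-refl _ refl refl refl

-- Recoding the output of a machine

isZeros : Str → Bool
isZeros []          = true
isZeros (false ∷ y) = isZeros y
isZeros (true ∷ y)  = false

data ZerosView : Str → Set where
  all-zeros : ∀ n → ZerosView (zeros n)
  has-one   : ∀ j y → ZerosView (zeros j ++ true ∷ y)

zerosView : ∀ y → ZerosView y
zerosView []          = all-zeros zero
zerosView (true ∷ y)  = has-one zero y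
zerosView (false ∷ y) with zerosView y
... | all-zeros n = all-zeros (suc n)
... | has-one j y′ = has-one (suc j) y′

isZeros-zeros : ∀ n → isZeros (zeros n) ≡ true
isZeros-zeros zero    = refl
isZeros-zeros (suc n) = isZeros-zeros n

isZeros-one : ∀ j y → isZeros (zeros j ++ true ∷ y) ≡ false
isZeros-one zero    y = refl
isZeros-one (suc j) y = isZeros-one j y

recode : Maybe Bool → Maybe Bool → ℕ → Str → Str
recode pZ pN k y = if isZeros y then fromMaybe pZ ++ y ++ zeros k else fromMaybe pN ++ y

recode-zeros : ∀ pZ pN k n → recode pZ pN k (zeros n) ≡ fromMaybe pZ ++ zeros (n + k)
recode-zeros pZ pN k n rewrite isZeros-zeros n = cong (fromMaybe pZ ++_) (zeros-+ n k)

recode-one : ∀ pZ pN k j y → recode pZ pN k (zeros j ++ true ∷ y) ≡ fromMaybe pN ++ zeros j ++ true ∷ y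
recode-one pZ pN k j y rewrite isZeros-one j y = refl

encode-one : ∀ j y t → encode (zeros j ++ true ∷ y) ++ blank ∷ t ≡ encode (zeros j) ++ s1 ∷ encode y ++ blank ∷ t
encode-one j y t = trans (cong (_++ blank ∷ t) (encode-++ (zeros j) (true ∷ y))) (++-assoc (encode (zeros j)) _ _)

length-one : ∀ j y → length (zeros j ++ true ∷ y) ≡ j + suc (length y)
length-one j y = trans (length-++ (zeros j)) (cong (_+ suc (length y)) (length-replicate j))

zeros-time : ∀ k n → 3 + (n + (suc k + (suc (n + k) + suc 2))) ≡ 2 * n + 2 * k + 8
zeros-time = solve-∀

one-time : ∀ k j m → 2 * (j + suc m) + 2 * k + 8 ≡ (3 + (j + suc (suc j + suc 2))) + (2 * m + 2 + 2 * k)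
one-time = solve-∀

clamp : ∀ k → ℕ → Fin (suc k)
clamp k       zero    = zero
clamp zero    (suc m) = zero
clamp (suc k) (suc m) = suc (clamp k m)

toℕ-clamp : ∀ k m → m ≤ k → toℕ (clamp k m) ≡ m
toℕ-clamp k       zero    _         = refl
toℕ-clamp (suc k) (suc m) (s≤s m≤k) = cong suc (toℕ-clamp k m m≤k)

-- The Bool of rewind and finish records whether the output was in 0*.
data RecodePhase : Set where
  mark-prefix mark-delimiter skip-prefix scan : RecodePhase
  rewind finish : Bool → RecodePhase
  leave stop : RecodePhase

RecodePhase-enum : FinEnum RecodePhase
RecodePhase-enum = record { size = 10 ; toFin = to ; fromFin = from ; fromFin-toFin = from-to }
  where
  to : RecodePhase → Fin 10
  to mark-prefix    = zero
  to mark-delimiter = suc zero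
  to skip-prefix    = suc (suc zero)
  to scan           = suc (suc (suc zero))
  to (rewind false) = suc (suc (suc (suc zero)))
  to (rewind true)  = suc (suc (suc (suc (suc zero))))
  to (finish false) = suc (suc (suc (suc (suc (suc zero)))))
  to (finish true)  = suc (suc (suc (suc (suc (suc (suc zero))))))
  to leave          = suc (suc (suc (suc (suc (suc (suc (suc zero)))))))
  to stop           = suc (suc (suc (suc (suc (suc (suc (suc (suc zero))))))))
  from : Fin 10 → RecodePhase
  from zero                                                       = mark-prefix
  from (suc zero)                                                 = mark-delimiter
  from (suc (suc zero))                                           = skip-prefix
  from (suc (suc (suc zero)))                                     = scan
  from (suc (suc (suc (suc zero))))                               = rewind false
  from (suc (suc (suc (suc (suc zero)))))                         = rewind true
  from (suc (suc (suc (suc (suc (suc zero))))))                   = finish false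
  from (suc (suc (suc (suc (suc (suc (suc zero)))))))             = finish true
  from (suc (suc (suc (suc (suc (suc (suc (suc zero))))))))       = leave
  from (suc (suc (suc (suc (suc (suc (suc (suc (suc zero))))))))) = stop
  from-to : ∀ p → from (to p) ≡ p
  from-to mark-prefix    = refl
  from-to mark-delimiter = refl
  from-to skip-prefix    = refl
  from-to scan           = refl
  from-to (rewind false) = refl
  from-to (rewind true)  = refl
  from-to (finish false) = refl
  from-to (finish true)  = refl
  from-to leave          = refl
  from-to stop           = refl

-- Run Mm; when it halts, mark the cell left of its output as the place of the leading bit,
-- then recode the output in place.
module Recode (Mm : TM) (pZ pN : Maybe Bool) (k : ℕ) where

  RState : Set
  RState = Fin (TM.nStates Mm) ⊎ (RecodePhase ⊎ Fin (suc k))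

  pattern phase p  = inj₂ (inj₁ p)
  pattern append j = inj₂ (inj₂ j)

  append-step : ℕ → Action RState
  append-step zero    = just (phase (rewind true) , blank , L)
  append-step (suc m) = just (append (clamp k m) , s0 , R)

  prefix-step : Maybe Bool → Action RState
  prefix-step (just c) = just (phase leave , bit c , L)
  prefix-step nothing  = just (phase stop , s0 , R)

  on-halt : Action (Fin (TM.nStates Mm)) → Sym → Action RState
  on-halt (just (q , w , d)) h = just (inj₁ q , w , d)
  on-halt nothing            h = just (phase mark-prefix , h , L)

  δR : RState → Sym → Action RState
  δR (inj₁ q)                 h     = on-halt (TM.δ Mm q h) h
  δR (phase mark-prefix)      h     = just (phase mark-delimiter , s0 , L)
  δR (phase mark-delimiter)   h     = just (phase skip-prefix , blank , R)
  δR (phase skip-prefix)      h     = just (phase scan , s0 , R)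
  δR (phase scan)             s0    = just (phase scan , s0 , R)
  δR (phase scan)             s1    = just (phase (rewind false) , s1 , L)
  δR (phase scan)             blank = append-step k
  δR (phase (rewind z))       blank = just (phase (finish z) , blank , R)
  δR (phase (rewind z))       a     = just (phase (rewind z) , a , L)
  δR (phase (finish z))       h     = prefix-step (if z then pZ else pN)
  δR (phase leave)            h     = just (phase stop , h , R)
  δR (phase stop)             h     = nothing
  δR (append j)               h     = append-step (toℕ j)

  RecodeM : FinMachine
  RecodeM = record
    { State = RState
    ; enum  = Fin-enum _ ⊎-enum (RecodePhase-enum ⊎-enum Fin-enum (suc k))
    ; start = inj₁ (TM.start Mm)
    ; δ     = δR
    }

  MR : TM
  MR = compile RecodeM

  time : ℕ → ℕ
  time n = 2 * n + 2 * k + 8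

  private
    append-steps : ∀ m → m ≤ k → ∀ X l h r → δR X h ≡ append-step m →
                   Σ (List Sym) λ r′ → steps MR (suc m) (gcfg RecodeM X l h r)
                     ≡ just (gconf RecodeM (phase (rewind true)) (tl (encode (zeros m) ʳ++ l)) (hd (encode (zeros m) ʳ++ l) ∷ blank ∷ r′))
    append-steps zero    _   X l h r e = r , steps-L RecodeM X l h r 0 e refl
    append-steps (suc m) m<k X l h r e =
      let r′ , e′ = append-steps m (<⇒≤ m<k) (append (clamp k m)) (s0 ∷ l) (hd r) (tl r)
                                 (cong append-step (toℕ-clamp k m (<⇒≤ m<k)))
      in r′ , steps-R RecodeM X l h r (suc m) e e′

    rewind-zeros : ∀ z m Γ r → steps MR m (gconf RecodeM (phase (rewind z)) (tl (encode (zeros m) ʳ++ blank ∷ Γ))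
                                                                         (hd (encode (zeros m) ʳ++ blank ∷ Γ) ∷ r))
                               ≡ just (gconf RecodeM (phase (rewind z)) Γ (blank ∷ encode (zeros m) ++ r))
    rewind-zeros z m Γ r =
      subst (λ n → steps MR n (gconf RecodeM (phase (rewind z)) (tl (encode (zeros m) ʳ++ blank ∷ Γ))
                                                                 (hd (encode (zeros m) ʳ++ blank ∷ Γ) ∷ r))
                   ≡ just (gconf RecodeM (phase (rewind z)) Γ (blank ∷ encode (zeros m) ++ r)))
            (length-replicate m) (scan-left RecodeM δ-rewind (zeros m) (blank ∷ Γ) r refl)
      where
      δ-rewind : ∀ a → δR (phase (rewind z)) (bit a) ≡ just (phase (rewind z) , bit a , L)
      δ-rewind false = refl
      δ-rewind true  = refl

    finish-Run : ∀ {z} p → (∀ h → δR (phase (finish z)) h ≡ prefix-step p) → ∀ Γ u t →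
                 Run MR 2 (gconf RecodeM (phase (finish z)) (blank ∷ Γ) (s0 ∷ encode u ++ blank ∷ t)) (fromMaybe p ++ u)
    finish-Run {z} (just c) δ-finish Γ u t =
      Run-L RecodeM (phase (finish z)) (blank ∷ Γ) s0 (encode u ++ blank ∷ t) (δ-finish s0)
      (Run-R RecodeM (phase leave) Γ blank (bit c ∷ encode u ++ blank ∷ t) refl
      (Run-halt MR (ghalt RecodeM (phase stop) (blank ∷ Γ) (bit c) (encode u ++ blank ∷ t) refl) (readOut-encode (c ∷ u) t)))
    finish-Run {z} nothing δ-finish Γ u t =
      Run-weaken (n≤1+n 1)
      (Run-R RecodeM (phase (finish z)) (blank ∷ Γ) s0 (encode u ++ blank ∷ t) (δ-finish s0)
      (Run-halt MR (ghalt RecodeM (phase stop) (s0 ∷ blank ∷ Γ) _ _ refl) (trans (cong readOut (hd∷tl u t)) (readOut-encode u t))))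

    zeros-Run : ∀ Γ n t → Run MR (n + (suc k + (suc (n + k) + suc 2)))
                                 (gconf RecodeM (phase scan) (s0 ∷ blank ∷ Γ) (encode (zeros n) ++ blank ∷ t))
                                 (fromMaybe pZ ++ zeros (n + k))
    zeros-Run Γ n t =
      let r′ , appended = append-steps k ≤-refl (phase scan) (encode (zeros (suc n)) ʳ++ blank ∷ Γ) blank t refl in
      Run-prefix MR n (scan-zeros-right RecodeM {phase scan} refl n (s0 ∷ blank ∷ Γ) (blank ∷ t))
      (Run-prefix MR (suc k) appended
      (Run-prefix MR (suc (n + k)) (subst (λ u → steps MR (suc (n + k)) (gconf RecodeM (phase (rewind true)) (tl u) (hd u ∷ blank ∷ r′))
                                                ≡ just (gconf RecodeM (phase (rewind true)) Γ (blank ∷ encode (zeros (suc (n + k))) ++ blank ∷ r′)))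
                                          (sym written) (rewind-zeros true (suc (n + k)) Γ (blank ∷ r′)))
      (Run-R RecodeM (phase (rewind true)) Γ blank (encode (zeros (suc (n + k))) ++ blank ∷ r′) refl
      (finish-Run pZ (λ _ → refl) Γ (zeros (n + k)) r′))))
      where
      written : encode (zeros k) ʳ++ encode (zeros (suc n)) ʳ++ blank ∷ Γ ≡ encode (zeros (suc (n + k))) ʳ++ blank ∷ Γ
      written = begin
        encode (zeros k) ʳ++ encode (zeros (suc n)) ʳ++ blank ∷ Γ   ≡⟨ ++-ʳ++ (encode (zeros (suc n))) ⟨
        (encode (zeros (suc n)) ++ encode (zeros k)) ʳ++ blank ∷ Γ  ≡⟨ cong (_ʳ++ blank ∷ Γ) (encode-++ (zeros (suc n)) (zeros k)) ⟨
        encode (zeros (suc n) ++ zeros k) ʳ++ blank ∷ Γ             ≡⟨ cong (λ u → encode u ʳ++ blank ∷ Γ) (zeros-+ (suc n) k) ⟩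
        encode (zeros (suc (n + k))) ʳ++ blank ∷ Γ                  ∎
        where open ≡-Reasoning

    one-Run : ∀ Γ j y t → Run MR (j + suc (suc j + suc 2))
                                 (gconf RecodeM (phase scan) (s0 ∷ blank ∷ Γ) (encode (zeros j) ++ s1 ∷ encode y ++ blank ∷ t))
                                 (fromMaybe pN ++ zeros j ++ true ∷ y)
    one-Run Γ j y t =
      Run-prefix MR j (scan-zeros-right RecodeM {phase scan} refl j (s0 ∷ blank ∷ Γ) (s1 ∷ v))
      (Run-L RecodeM (phase scan) (encode (zeros (suc j)) ʳ++ blank ∷ Γ) s1 v refl
      (Run-prefix MR (suc j) (rewind-zeros false (suc j) Γ (s1 ∷ v))
      (Run-R RecodeM (phase (rewind false)) Γ blank (encode (zeros (suc j)) ++ s1 ∷ v) refl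
      (subst (λ u → Run MR 2 (gconf RecodeM (phase (finish false)) (blank ∷ Γ) (s0 ∷ u)) (fromMaybe pN ++ zeros j ++ true ∷ y))
             (encode-one j y t) (finish-Run pN (λ _ → refl) Γ (zeros j ++ true ∷ y) t)))))
      where
      v = encode y ++ blank ∷ t

    scan-Run : ∀ Γ t y → ZerosView y →
               Σ ℕ λ m → 3 + m ≤ time (length y) ×
                 Run MR m (gconf RecodeM (phase scan) (s0 ∷ blank ∷ Γ) (encode y ++ blank ∷ t)) (recode pZ pN k y)
    scan-Run Γ t .(zeros n) (all-zeros n) rewrite recode-zeros pZ pN k n | length-replicate n {false} =
      _ , ≤-reflexive (zeros-time k n) , zeros-Run Γ n t
    scan-Run Γ t .(zeros j ++ true ∷ y) (has-one j y) rewrite recode-one pZ pN k j y | length-one j y | encode-one j y t =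
      _ , subst (3 + (j + suc (suc j + suc 2)) ≤_) (sym (one-time k j (length y))) (m≤m+n _ _) , one-Run Γ j y t

    mark-Run : ∀ l a y t {m y′} → Run MR m (gconf RecodeM (phase scan) (s0 ∷ blank ∷ tl l) (encode y ++ blank ∷ t)) y′ →
               Run MR (3 + m) (gconf RecodeM (phase mark-prefix) l (a ∷ encode y ++ blank ∷ t)) y′
    mark-Run l a y t r =
      Run-L RecodeM (phase mark-prefix) l a (encode y ++ blank ∷ t) refl
      (Run-R RecodeM (phase mark-delimiter) (tl l) (hd l) (s0 ∷ encode y ++ blank ∷ t) refl
      (Run-R RecodeM (phase skip-prefix) (blank ∷ tl l) s0 (encode y ++ blank ∷ t) refl r))

    marked-Run : ∀ l a y t → Run MR (time (length y)) (gconf RecodeM (phase mark-prefix) l (a ∷ encode y ++ blank ∷ t))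
                                    (recode pZ pN k y)
    marked-Run l a y t = let m , le , r = scan-Run (tl l) t y (zerosView y) in Run-weaken le (mark-Run l a y t r)

    δ-sim : ∀ {q h q′ w d} → TM.δ Mm q h ≡ just (q′ , w , d) → δR (inj₁ q) h ≡ just (inj₁ q′ , w , d)
    δ-sim e rewrite e = refl

    module S = Simulation Mm RecodeM inj₁ δ-sim

    embed-initial : ∀ x → S.embed (initial Mm x) ≡ initial MR x
    embed-initial []      = refl
    embed-initial (b ∷ x) = refl

  recode-Run : ∀ x {t y} → Run Mm t (initial Mm x) y → Run MR (t + suc (time (length y))) (initial MR x) (recode pZ pN k y)
  recode-Run x (run n le (cfg q l h r) reach halted refl) =
    let t′ , shape = readOut-shape (h ∷ r) in
    Run-weaken (+-monoˡ-≤ _ le)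
      (Run-prefix MR n (subst (λ c → steps MR n c ≡ just (S.embed (cfg q l h r))) (embed-initial x) (S.embed-steps n _ reach))
      (Run-L RecodeM (inj₁ q) l h r (cong (λ a → on-halt a h) (halted⇒δ-nothing Mm q l h r halted))
      (Run-≅ MR (conf-≅ _ (~-refl (tl l)) (cons (hd l) (~-sym shape))) (marked-Run (tl l) (hd l) (readOut (h ∷ r)) t′))))

push : ℕ → Bool → ℕ
push c false = 2 * suc c
push c true  = suc (2 * c)

code : Str → ℕ
code = foldl push 0

push-≥ : ∀ c b → c ≤ push c b
push-≥ c false = ≤-trans (n≤1+n c) (m≤m+n (suc c) _)
push-≥ c true  = ≤-trans (m≤m+n c (c + 0)) (n≤1+n _)

foldl-push-≥ : ∀ c x → c ≤ foldl push c x
foldl-push-≥ c []      = ≤-refl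
foldl-push-≥ c (b ∷ x) = ≤-trans (push-≥ c b) (foldl-push-≥ (push c b) x)

-- code x is the value of the bijective base-2 numeral of reverse x, which makes code injective.
numeral : Str → ℕᵇ
numeral []          = zeroᵇ
numeral (false ∷ ρ) = 2[1+ numeral ρ ]
numeral (true ∷ ρ)  = 1+[2 numeral ρ ]

numeral-injective : ∀ {ρ ρ′} → numeral ρ ≡ numeral ρ′ → ρ ≡ ρ′
numeral-injective {[]}        {[]}         _ = refl
numeral-injective {false ∷ ρ} {false ∷ ρ′} e = cong (false ∷_) (numeral-injective (2[1+_]-injective e))
numeral-injective {true ∷ ρ}  {true ∷ ρ′}  e = cong (true ∷_) (numeral-injective (1+[2_]-injective e))
numeral-injective {[]}        {false ∷ _}  ()
numeral-injective {[]}        {true ∷ _}   ()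
numeral-injective {false ∷ _} {[]}         ()
numeral-injective {true ∷ _}  {[]}         ()
numeral-injective {false ∷ _} {true ∷ _}   ()
numeral-injective {true ∷ _}  {false ∷ _}  ()

foldl-push-numeral : ∀ x ρ → foldl push (toℕᵇ (numeral ρ)) x ≡ toℕᵇ (numeral (x ʳ++ ρ))
foldl-push-numeral []          ρ = refl
foldl-push-numeral (false ∷ x) ρ = foldl-push-numeral x (false ∷ ρ)
foldl-push-numeral (true ∷ x)  ρ = foldl-push-numeral x (true ∷ ρ)

code-injective : ∀ {x y} → code x ≡ code y → x ≡ y
code-injective {x} {y} e =
  reverse-injective (numeral-injective (toℕᵇ-injective (trans (sym (foldl-push-numeral x [])) (trans e (foldl-push-numeral y [])))))

maxCode : List Str → ℕ
maxCode []       = 0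
maxCode (b ∷ bs) = code b ⊔ maxCode bs

maxCode-≥ : ∀ {x} l → x ∈ l → code x ≤ maxCode l
maxCode-≥ (b ∷ l) (here refl) = m≤m⊔n _ _
maxCode-≥ (b ∷ l) (there x∈l) = ≤-trans (maxCode-≥ l x∈l) (m≤n⊔m _ _)

position : ℕ → List Str → ℕ
position n []      = 0
position n (b ∷ l) with code b ≟ n
... | yes _ = 0
... | no  _ = suc (position n l)

nth : ℕ → List Str → Str
nth _       []      = []
nth zero    (x ∷ l) = x
nth (suc i) (x ∷ l) = nth i l

nth-∈ : ∀ i l → i < length l → nth i l ∈ l
nth-∈ zero    (x ∷ l) _          = here refl
nth-∈ (suc i) (x ∷ l) (s≤s i<l) = there (nth-∈ i l i<l)

position-≤ : ∀ n l → position n l ≤ length l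
position-≤ n []      = z≤n
position-≤ n (b ∷ l) with code b ≟ n
... | yes _ = z≤n
... | no  _ = s≤s (position-≤ n l)

position-nth : ∀ {l} → Unique l → ∀ i → i < length l → position (code (nth i l)) l ≡ i
position-nth {x ∷ l} (x∉l ∷ _) zero _ with code x ≟ code x
... | yes _ = refl
... | no  c≢c = ⊥-elim (c≢c refl)
position-nth {x ∷ l} (x∉l ∷ u) (suc i) (s≤s i<l) with code x ≟ code (nth i l)
... | yes e = ⊥-elim (All.lookup x∉l (nth-∈ i l i<l) (code-injective e))
... | no  _ = cong suc (position-nth u i i<l)

nth-position : ∀ {x} l → x ∈ l → nth (position (code x) l) l ≡ x × position (code x) l < length l
nth-position {x} (b ∷ l) x∈l with code b ≟ code x
... | yes e = code-injective e , s≤s z≤n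
nth-position (b ∷ l) (here refl)  | no c≢c = ⊥-elim (c≢c refl)
nth-position (b ∷ l) (there x∈l) | no _   = Product.map₂ s≤s (nth-position l x∈l)

-- Read the code of a word of bs, then write 0^i for its position i in bs.
module Index (bs : List Str) where

  K N : ℕ
  K = length bs
  N = suc (maxCode bs)

  -- The code read so far, or overflow.
  Reading : Set
  Reading = Fin N ⊎ ⊤

  next : Reading → Bool → Reading
  next (inj₁ c) b with push (toℕ c) b <? N
  ... | yes p = inj₁ (fromℕ< p)
  ... | no  _ = inj₂ tt
  next (inj₂ tt) b = inj₂ tt

  positionOf : Reading → ℕ
  positionOf (inj₁ c) = position (toℕ c) bs
  positionOf (inj₂ _) = 0

  index : Str → Str
  index x = zeros (positionOf (foldl next (inj₁ zero) x))

  IState : Set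
  IState = Reading ⊎ (Fin (suc K) ⊎ ⊤)

  pattern writing j = inj₂ (inj₁ j)
  pattern halt      = inj₂ (inj₂ tt)

  write-step : ℕ → Sym → Action IState
  write-step zero    h = just (halt , h , R)
  write-step (suc m) h = just (writing (clamp K m) , s0 , L)

  δI : IState → Sym → Action IState
  δI (inj₁ s)    s0    = just (inj₁ (next s false) , s0 , R)
  δI (inj₁ s)    s1    = just (inj₁ (next s true) , s1 , R)
  δI (inj₁ s)    blank = just (writing (clamp K (positionOf s)) , blank , L)
  δI (writing j) h     = write-step (toℕ j) h
  δI halt        h     = nothing

  IndexM : FinMachine
  IndexM = record
    { State = IState
    ; enum  = (Fin-enum N ⊎-enum ⊤-enum) ⊎-enum (Fin-enum (suc K) ⊎-enum ⊤-enum)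
    ; start = inj₁ (inj₁ zero)
    ; δ     = δI
    }

  MI : TM
  MI = compile IndexM

  private
    δ-read : ∀ s a → δI (inj₁ s) (bit a) ≡ just (inj₁ (next s a) , bit a , R)
    δ-read s false = refl
    δ-read s true  = refl

    write-zeros : ∀ m → m ≤ K → ∀ l a r → Σ (List Sym) λ l′ → Σ Sym λ a′ →
                  steps MI m (gcfg IndexM (writing (clamp K m)) l a r) ≡ just (gcfg IndexM (writing zero) l′ a′ (encode (zeros m) ++ r))
    write-zeros zero    _   l a r = l , a , refl
    write-zeros (suc m) m≤K l a r =
      let l′ , a′ , e = write-zeros m (≤-trans (n≤1+n m) m≤K) (tl l) (hd l) (s0 ∷ r) in
      l′ , a′ , steps-L IndexM (writing (clamp K (suc m))) l a r m (cong (λ j → write-step j a) (toℕ-clamp K (suc m) m≤K))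
                  (subst (λ u → steps MI m (gcfg IndexM (writing (clamp K m)) (tl l) (hd l) (s0 ∷ r))
                                ≡ just (gcfg IndexM (writing zero) l′ a′ u))
                         (zeros-snoc m r) e)

    positionOf-≤ : ∀ s → positionOf s ≤ K
    positionOf-≤ (inj₁ c) = position-≤ (toℕ c) bs
    positionOf-≤ (inj₂ _) = z≤n

  index-Run : ∀ x → Run MI (length x + suc (K + 1)) (initial MI x) (index x)
  index-Run x =
    let l′ , a′ , written = write-zeros m (positionOf-≤ s) (tl (encode x ʳ++ [])) (hd (encode x ʳ++ [])) (blank ∷ []) in
    Run-≅ MI padded
      (Run-prefix MI (length x) (scan-right IndexM inj₁ next δ-read (inj₁ zero) x [] (blank ∷ []))
      (Run-L IndexM (inj₁ s) (encode x ʳ++ []) blank [] refl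
      (Run-weaken (+-monoˡ-≤ 1 (positionOf-≤ s))
      (Run-prefix MI m written
      (Run-R IndexM (writing zero) l′ a′ (encode (zeros m) ++ blank ∷ []) refl
      (Run-halt MI (ghalt IndexM halt (a′ ∷ l′) _ _ refl)
                (trans (cong readOut (hd∷tl (zeros m) [])) (readOut-encode (zeros m) []))))))))
    where
    s = foldl next (inj₁ zero) x
    m = positionOf s
    padded : gconf IndexM (inj₁ (inj₁ zero)) [] (encode x ++ blank ∷ []) ≅ initial MI x
    padded rewrite gconf-initial IndexM x = conf-≅ _ nil (++-blank~ (encode x))

  reads-code : ∀ (c : Fin N) x → foldl push (toℕ c) x < N →
               Σ (Fin N) λ c′ → foldl next (inj₁ c) x ≡ inj₁ c′ × toℕ c′ ≡ foldl push (toℕ c) x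
  reads-code c []      _ = c , refl , refl
  reads-code c (b ∷ x) lt with push (toℕ c) b <? N
  ... | yes p = let c′ , e , t = reads-code (fromℕ< p) x (subst (λ n → foldl push n x < N) (sym (toℕ-fromℕ< p)) lt) in
                c′ , e , trans t (cong (λ n → foldl push n x) (toℕ-fromℕ< p))
  ... | no ¬p = ⊥-elim (¬p (≤-<-trans (foldl-push-≥ (push (toℕ c) b) x) lt))

  index-∈ : ∀ {x} → x ∈ bs → index x ≡ zeros (position (code x) bs)
  index-∈ {x} x∈bs with reads-code zero x (s≤s (maxCode-≥ bs x∈bs))
  ... | c′ , e , t rewrite e | t = refl

-- Bounds of the form c (n+1)^k are monotone in n and closed under sums, unlike c n^k + c.
poly : ℕ → ℕ → ℕ → ℕ
poly c k n = c * suc n ^ k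

poly-mono : ∀ c k {m n} → m ≤ n → poly c k m ≤ poly c k n
poly-mono c k m≤n = *-monoʳ-≤ c (^-monoˡ-≤ k (s≤s m≤n))

poly-+ : ∀ c k c′ k′ n → poly c k n + poly c′ k′ n ≤ poly (c + c′) (k ⊔ k′) n
poly-+ c k c′ k′ n = begin
  c * suc n ^ k + c′ * suc n ^ k′                 ≤⟨ +-mono-≤ (*-monoʳ-≤ c (^-monoʳ-≤ (suc n) (m≤m⊔n k k′)))
                                                              (*-monoʳ-≤ c′ (^-monoʳ-≤ (suc n) (m≤n⊔m k k′))) ⟩
  c * suc n ^ (k ⊔ k′) + c′ * suc n ^ (k ⊔ k′)   ≡⟨ *-distribʳ-+ (suc n ^ (k ⊔ k′)) c c′ ⟨
  (c + c′) * suc n ^ (k ⊔ k′)                     ∎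
  where open ≤-Reasoning

poly-scale : ∀ a c k n → a * poly c k n ≡ poly (a * c) k n
poly-scale a c k n = sym (*-assoc a c _)

affine≤poly : ∀ a b n → a * n + b ≤ poly (a + b) 1 n
affine≤poly a b n = ≤-trans (m≤m+n (a * n + b) (a + b * n)) (≤-reflexive (expand a b n))
  where
  expand : ∀ a b n → a * n + b + (a + b * n) ≡ (a + b) * (suc n * 1)
  expand = solve-∀

standard≤poly : ∀ c k n → c * n ^ k + c ≤ poly (c + c) k n
standard≤poly c k n = begin
  c * n ^ k + c                  ≤⟨ +-mono-≤ (*-monoʳ-≤ c (^-monoˡ-≤ k (n≤1+n n)))
                                              (m≤m*n c (suc n ^ k) {{>-nonZero (m^n>0 (suc n) k)}}) ⟩
  c * suc n ^ k + c * suc n ^ k  ≡⟨ *-distribʳ-+ (suc n ^ k) c c ⟨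
  (c + c) * suc n ^ k            ∎
  where open ≤-Reasoning

-- (n+1)^k ≤ 2^k n^k + 1, checked separately for n = 0 and n ≥ 1.
poly≤standard : ∀ c k n → poly c k n ≤ (c * 2 ^ k) * n ^ k + c * 2 ^ k
poly≤standard c k n = begin
  c * suc n ^ k                       ≤⟨ *-monoʳ-≤ c (suc-pow n k) ⟩
  c * (2 ^ k * n ^ k + 1)             ≡⟨ distribute c (2 ^ k) (n ^ k) ⟩
  (c * 2 ^ k) * n ^ k + c             ≤⟨ +-monoʳ-≤ ((c * 2 ^ k) * n ^ k) (m≤m*n c (2 ^ k) {{>-nonZero (m^n>0 2 k)}}) ⟩
  (c * 2 ^ k) * n ^ k + c * 2 ^ k     ∎
  where
  open ≤-Reasoning
  distribute : ∀ c a b → c * (a * b + 1) ≡ (c * a) * b + c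
  distribute = solve-∀
  double : ∀ n k → suc (suc n) ^ k ≤ 2 ^ k * suc n ^ k
  double n zero    = ≤-refl
  double n (suc k) = ≤-trans (*-mono-≤ (≤-trans (s≤s (s≤s (m≤m+n n n))) (≤-reflexive (twice n))) (double n k))
                             (≤-reflexive (interchange (2 ^ k) (suc n ^ k) n))
    where
    twice : ∀ n → suc (suc (n + n)) ≡ 2 * suc n
    twice = solve-∀
    interchange : ∀ a b n → (2 * suc n) * (a * b) ≡ (2 * a) * (suc n * b)
    interchange = solve-∀
  suc-pow : ∀ n k → suc n ^ k ≤ 2 ^ k * n ^ k + 1
  suc-pow zero    k = ≤-trans (≤-reflexive (^-zeroˡ k)) (m≤n+m 1 _)
  suc-pow (suc n) k = ≤-trans (double n k) (m≤m+n _ 1)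

record PolyComputable (h : Str → Str) : Set₁ where
  constructor poly-computable
  field
    machine : FinMachine
    c k     : ℕ
    runs    : ∀ x → Run (compile machine) (poly c k (length x)) (initial (compile machine) x) (h x)

PolyComputable⇒PolyTime : ∀ {h} → PolyComputable h → PolyTime h
PolyComputable⇒PolyTime (poly-computable G c k runs) =
  compile G , c * 2 ^ k , k , λ x → poly c k (length x) , poly≤standard c k (length x) , Run⇒exec (compile G) (runs x)

join-computable : ∀ {h₀ h₁} → PolyComputable h₀ → PolyComputable h₁ → PolyComputable (dispatch h₀ h₁)
join-computable {h₀} {h₁} (poly-computable G₀ c₀ k₀ runs₀) (poly-computable G₁ c₁ k₁ runs₁) =
  poly-computable JoinM (c₀ + c₁ + 4) (k₀ ⊔ k₁ ⊔ 1) runs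
  where
  open Join G₀ G₁
  T : ℕ → ℕ
  T = poly (c₀ + c₁) (k₀ ⊔ k₁)

  C K : ℕ
  C = c₀ + c₁ + 4
  K = k₀ ⊔ k₁ ⊔ 1

  branch-Run : ∀ b x → Run (compile (branch b)) (T (length x)) (initial _ x) ((if b then h₁ else h₀) x)
  branch-Run false x = Run-weaken (≤-trans (m≤m+n _ _) (poly-+ c₀ k₀ c₁ k₁ _)) (runs₀ x)
  branch-Run true  x = Run-weaken (≤-trans (m≤n+m _ _) (poly-+ c₀ k₀ c₁ k₁ _)) (runs₁ x)

  rearrange : ∀ n t → n + 1 + suc (suc (n + 1)) + t ≡ t + (2 * (n + 1) + 2)
  rearrange = solve-∀

  bound : ∀ x b → length (x ∷ʳ b) + suc (suc (length x + 1)) + T (length x) ≤ poly C K (length (x ∷ʳ b))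
  bound x b rewrite length-++ x {[ b ]} = begin
    n + 1 + suc (suc (n + 1)) + T n  ≡⟨ rearrange n (T n) ⟩
    T n + (2 * (n + 1) + 2)          ≤⟨ +-mono-≤ (poly-mono (c₀ + c₁) (k₀ ⊔ k₁) (m≤m+n n 1)) (affine≤poly 2 2 (n + 1)) ⟩
    T (n + 1) + poly 4 1 (n + 1)     ≤⟨ poly-+ (c₀ + c₁) (k₀ ⊔ k₁) 4 1 (n + 1) ⟩
    poly C K (n + 1)                 ∎
    where
    open ≤-Reasoning
    n = length x

  runs : ∀ w → Run M (poly C K (length w)) (initial M w) (dispatch h₀ h₁ w)
  runs w with initLast w
  ... | [] = Run-weaken (≤-trans (n≤1+n 1) (≤-trans (affine≤poly 2 2 0) (≤-trans (m≤n+m _ _) (poly-+ (c₀ + c₁) (k₀ ⊔ k₁) 4 1 0))))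
                        Run-[]
  ... | x ∷ʳ′ b = Run-weaken (bound x b) (Run-∷ʳ x b (branch-Run b x))

recode-computable : ∀ {f} → PolyTime f → ∀ pZ pN k → PolyComputable (λ x → recode pZ pN k (f x))
recode-computable {f} (Mm , c , k , computes) pZ pN K =
  poly-computable RecodeM (3 * (c + c) + (2 + (2 * K + 11))) (k ⊔ 1) λ x → Run-weaken (bound x) (recode-Run x (Mm-Run x))
  where
  open Recode Mm pZ pN K
  T : ℕ → ℕ
  T = poly (c + c) k

  Mm-Run : ∀ x → Run Mm (T (length x)) (initial Mm x) (f x)
  Mm-Run x = let t , t≤ , ex = computes x in Run-weaken (≤-trans t≤ (standard≤poly c k _)) (exec⇒Run Mm t _ ex)

  time-mono : ∀ {m n} → m ≤ n → time m ≤ time n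
  time-mono m≤n = +-monoˡ-≤ 8 (+-monoˡ-≤ (2 * K) (*-monoʳ-≤ 2 m≤n))

  rearrange : ∀ t n K → t + suc (2 * suc (t + n) + 2 * K + 8) ≡ 3 * t + (2 * n + (2 * K + 11))
  rearrange = solve-∀

  bound : ∀ x → T (length x) + suc (time (length (f x))) ≤ poly (3 * (c + c) + (2 + (2 * K + 11))) (k ⊔ 1) (length x)
  bound x = begin
    t + suc (time (length (f x)))                          ≤⟨ +-monoʳ-≤ t (s≤s (time-mono (Run-output-length Mm (Mm-Run x)))) ⟩
    t + suc (time (suc (t + n)))                           ≡⟨ rearrange t n K ⟩
    3 * t + (2 * n + (2 * K + 11))                         ≤⟨ +-mono-≤ (≤-reflexive (poly-scale 3 (c + c) k n))
                                                                       (affine≤poly 2 (2 * K + 11) n) ⟩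
    poly (3 * (c + c)) k n + poly (2 + (2 * K + 11)) 1 n   ≤⟨ poly-+ (3 * (c + c)) k (2 + (2 * K + 11)) 1 n ⟩
    poly (3 * (c + c) + (2 + (2 * K + 11))) (k ⊔ 1) n      ∎
    where
    open ≤-Reasoning
    n = length x
    t = T n

index-computable : ∀ bs → PolyComputable (Index.index bs)
index-computable bs = poly-computable IndexM (1 + (K + 2)) 1 λ x → Run-weaken (bound (length x)) (index-Run x)
  where
  open Index bs
  rearrange : ∀ n K → 1 * n + (K + 2) ≡ n + suc (K + 1)
  rearrange = solve-∀
  bound : ∀ n → n + suc (K + 1) ≤ poly (1 + (K + 2)) 1 n
  bound n = ≤-trans (≤-reflexive (sym (rearrange n K))) (affine≤poly 1 (K + 2) n)

-- Compression functions of joins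

record JointCompression (A B : Lang) (hA hB : Str → Str) : Set where
  field
    cover    : ∀ y → (∃[ a ] (A a × hA a ≡ y)) ⊎ (∃[ b ] (B b × hB b ≡ y))
    injᴬ     : ∀ {a a′} → A a → A a′ → hA a ≡ hA a′ → a ≡ a′
    injᴮ     : ∀ {b b′} → B b → B b′ → hB b ≡ hB b′ → b ≡ b′
    disjoint : ∀ {a b} → A a → B b → hA a ≢ hB b

JointCompression-swap : ∀ {A B hA hB} → JointCompression A B hA hB → JointCompression B A hB hA
JointCompression-swap j = record
  { cover    = λ y → Sum.swap (cover y)
  ; injᴬ     = injᴮ
  ; injᴮ     = injᴬ
  ; disjoint = λ Bb Aa e → disjoint Aa Bb (sym e)
  }
  where open JointCompression j

JointCompression⇒IsCompressionFunction : ∀ {A B hA hB} → JointCompression A B hA hB →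
                                          IsCompressionFunction (dispatch hA hB) (A ⊕ B)
JointCompression⇒IsCompressionFunction {A} {B} {hA} {hB} j = onto , injective
  where
  open JointCompression j
  onto : ∀ y → ∃[ x ] ((A ⊕ B) x × dispatch hA hB x ≡ y)
  onto y with cover y
  ... | inj₁ (a , Aa , e) = a ∷ʳ false , inl Aa , trans (dispatch-∷ʳ hA hB a false) e
  ... | inj₂ (b , Bb , e) = b ∷ʳ true  , inr Bb , trans (dispatch-∷ʳ hA hB b true) e
  injective : ∀ x x′ → (A ⊕ B) x → (A ⊕ B) x′ → x ≢ x′ → dispatch hA hB x ≢ dispatch hA hB x′
  injective _ _ (inl {a} Aa) (inl {a′} Aa′) x≢x′ e =
    x≢x′ (cong (_∷ʳ false) (injᴬ Aa Aa′ (trans (sym (dispatch-∷ʳ hA hB a false)) (trans e (dispatch-∷ʳ hA hB a′ false)))))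
  injective _ _ (inr {b} Bb) (inr {b′} Bb′) x≢x′ e =
    x≢x′ (cong (_∷ʳ true) (injᴮ Bb Bb′ (trans (sym (dispatch-∷ʳ hA hB b true)) (trans e (dispatch-∷ʳ hA hB b′ true)))))
  injective _ _ (inl {a} Aa) (inr {b} Bb) _ e =
    disjoint Aa Bb (trans (sym (dispatch-∷ʳ hA hB a false)) (trans e (dispatch-∷ʳ hA hB b true)))
  injective _ _ (inr {b} Bb) (inl {a} Aa) _ e =
    disjoint Aa Bb (sym (trans (sym (dispatch-∷ʳ hA hB b true)) (trans e (dispatch-∷ʳ hA hB a false))))

compression-injective : ∀ {f A} → IsCompressionFunction f A → ∀ {a a′} → A a → A a′ → f a ≡ f a′ → a ≡ a′
compression-injective (_ , inj) {a} {a′} Aa Aa′ e with ≡-dec Data.Bool._≟_ a a′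
... | yes a≡a′ = a≡a′
... | no  a≢a′ = ⊥-elim (inj a a′ Aa Aa′ a≢a′ e)

zeros-injective : ∀ {m n} → zeros m ≡ zeros n → m ≡ n
zeros-injective {m} {n} e = trans (sym (length-replicate m)) (trans (cong length e) (length-replicate n))

zeros≢one : ∀ n j y → zeros n ≢ zeros j ++ true ∷ y
zeros≢one n j y e with trans (sym (isZeros-zeros n)) (trans (cong isZeros e) (isZeros-one j y))
... | ()

-- tag₁ maps Σ* onto 1Σ*, and tag₀ maps it onto the complement {ε} ∪ 0Σ*.
tag₀ tag₁ : Str → Str
tag₀ = recode nothing (just false) 0
tag₁ = recode (just true) (just true) 0

tag₀-zeros : ∀ n → tag₀ (zeros n) ≡ zeros n
tag₀-zeros n = trans (recode-zeros nothing (just false) 0 n) (cong zeros (+-identityʳ n))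

tag₀-one : ∀ j y → tag₀ (zeros j ++ true ∷ y) ≡ false ∷ zeros j ++ true ∷ y
tag₀-one = recode-one nothing (just false) 0

tag₁≡true∷ : ∀ y → tag₁ y ≡ true ∷ y
tag₁≡true∷ y with zerosView y
... | all-zeros n = trans (recode-zeros (just true) (just true) 0 n) (cong (λ m → true ∷ zeros m) (+-identityʳ n))
... | has-one j y′ = recode-one (just true) (just true) 0 j y′

tag₀-injective : ∀ {y y′} → tag₀ y ≡ tag₀ y′ → y ≡ y′
tag₀-injective {y} {y′} e with zerosView y | zerosView y′
... | all-zeros n | all-zeros n′ = trans (sym (tag₀-zeros n)) (trans e (tag₀-zeros n′))
... | has-one j u | has-one j′ u′ = ∷-injectiveʳ (trans (sym (tag₀-one j u)) (trans e (tag₀-one j′ u′)))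
... | all-zeros n | has-one j′ u′ = ⊥-elim (zeros≢one n (suc j′) u′ (trans (sym (tag₀-zeros n)) (trans e (tag₀-one j′ u′))))
... | has-one j u | all-zeros n′ = ⊥-elim (zeros≢one n′ (suc j) u (trans (sym (tag₀-zeros n′)) (trans (sym e) (tag₀-one j u))))

tag₀≢true∷ : ∀ y z → tag₀ y ≢ true ∷ z
tag₀≢true∷ y z e with zerosView y
... | all-zeros zero    = case e of λ ()
... | all-zeros (suc n) = case trans (sym (tag₀-zeros (suc n))) e of λ ()
... | has-one j y′      = case trans (sym (tag₀-one j y′)) e of λ ()

tag₀-or-true∷ : ∀ y → (∃[ u ] tag₀ u ≡ y) ⊎ (∃[ u ] true ∷ u ≡ y)
tag₀-or-true∷ []          = inj₁ ([] , refl)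
tag₀-or-true∷ (true ∷ y)  = inj₂ (y , refl)
tag₀-or-true∷ (false ∷ y) with zerosView y
... | all-zeros n  = inj₁ (zeros (suc n) , tag₀-zeros (suc n))
... | has-one j y′ = inj₁ (zeros j ++ true ∷ y′ , tag₀-one j y′)

-- shift K maps Σ* onto the complement of {0^i | i < K}.
shift : ℕ → Str → Str
shift K = recode nothing nothing K

module _ (K : ℕ) where

  shift-zeros : ∀ n → shift K (zeros n) ≡ zeros (n + K)
  shift-zeros = recode-zeros nothing nothing K

  shift-one : ∀ j y → shift K (zeros j ++ true ∷ y) ≡ zeros j ++ true ∷ y
  shift-one = recode-one nothing nothing K

  shift-injective : ∀ {y y′} → shift K y ≡ shift K y′ → y ≡ y′
  shift-injective {y} {y′} e with zerosView y | zerosView y′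
  ... | all-zeros n | all-zeros n′ =
    cong zeros (+-cancelʳ-≡ K n n′ (zeros-injective (trans (sym (shift-zeros n)) (trans e (shift-zeros n′)))))
  ... | has-one j u | has-one j′ u′ = trans (sym (shift-one j u)) (trans e (shift-one j′ u′))
  ... | all-zeros n | has-one j′ u′ = ⊥-elim (zeros≢one (n + K) j′ u′ (trans (sym (shift-zeros n)) (trans e (shift-one j′ u′))))
  ... | has-one j u | all-zeros n′ = ⊥-elim (zeros≢one (n′ + K) j u (trans (sym (shift-zeros n′)) (trans (sym e) (shift-one j u))))

  shift≢short-zeros : ∀ y {i} → i < K → shift K y ≢ zeros i
  shift≢short-zeros y i<K e with zerosView y
  ... | all-zeros n  = <⇒≱ i<K (≤-trans (m≤n+m K n) (≤-reflexive (zeros-injective (trans (sym (shift-zeros n)) e))))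
  ... | has-one j u  = zeros≢one _ j u (sym (trans (sym (shift-one j u)) e))

  short-zeros-or-shift : ∀ y → (∃[ i ] (i < K × zeros i ≡ y)) ⊎ (∃[ u ] shift K u ≡ y)
  short-zeros-or-shift y with zerosView y
  short-zeros-or-shift .(zeros m) | all-zeros m with m <? K
  ... | yes m<K = inj₁ (m , m<K , refl)
  ... | no  m≮K = inj₂ (zeros (m ∸ K) , trans (shift-zeros (m ∸ K)) (cong zeros (m∸n+n≡m (≮⇒≥ m≮K))))
  short-zeros-or-shift .(zeros j ++ true ∷ y) | has-one j y = inj₂ (zeros j ++ true ∷ y , shift-one j y)

tagged-joint : ∀ {A B fA fB} → IsCompressionFunction fA A → IsCompressionFunction fB B →
               JointCompression A B (λ x → tag₀ (fA x)) (λ x → tag₁ (fB x))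
tagged-joint {A} {B} {fA} {fB} cA cB = record
  { cover    = cover
  ; injᴬ     = λ Aa Aa′ e → compression-injective cA Aa Aa′ (tag₀-injective e)
  ; injᴮ     = λ Bb Bb′ e →
                 compression-injective cB Bb Bb′ (∷-injectiveʳ (trans (sym (tag₁≡true∷ _)) (trans e (tag₁≡true∷ _))))
  ; disjoint = λ {a} {b} _ _ e → tag₀≢true∷ (fA a) (fB b) (trans e (tag₁≡true∷ (fB b)))
  }
  where
  cover : ∀ y → (∃[ a ] (A a × tag₀ (fA a) ≡ y)) ⊎ (∃[ b ] (B b × tag₁ (fB b) ≡ y))
  cover y with tag₀-or-true∷ y
  ... | inj₁ (u , e) = let a , Aa , ea = proj₁ cA u in inj₁ (a , Aa , trans (cong tag₀ ea) e)
  ... | inj₂ (u , e) = let b , Bb , eb = proj₁ cB u in inj₂ (b , Bb , trans (tag₁≡true∷ (fB b)) (trans (cong (true ∷_) eb) e))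

shifted-joint : ∀ {A B fA bs} → IsCompressionFunction fA A → Unique bs → (∀ x → B x ⇔ x ∈ bs) →
                JointCompression A B (λ x → shift (length bs) (fA x)) (Index.index bs)
shifted-joint {A} {B} {fA} {bs} cA unique B⇔ = record
  { cover    = cover
  ; injᴬ     = λ Aa Aa′ e → compression-injective cA Aa Aa′ (shift-injective K e)
  ; injᴮ     = injᴮ
  ; disjoint = λ {a} _ Bb e → shift≢short-zeros K (fA a) (proj₂ (nth-position bs (∈bs Bb))) (trans e (index-∈ (∈bs Bb)))
  }
  where
  open Index bs using (index; index-∈)
  K = length bs
  ∈bs : ∀ {x} → B x → x ∈ bs
  ∈bs = Equivalence.to (B⇔ _)

  cover : ∀ y → (∃[ a ] (A a × shift K (fA a) ≡ y)) ⊎ (∃[ b ] (B b × index b ≡ y))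
  cover y with short-zeros-or-shift K y
  ... | inj₁ (i , i<K , refl) =
    inj₂ (nth i bs , Equivalence.from (B⇔ _) (nth-∈ i bs i<K) , trans (index-∈ (nth-∈ i bs i<K)) (cong zeros (position-nth unique i i<K)))
  ... | inj₂ (u , e) = let a , Aa , ea = proj₁ cA u in inj₁ (a , Aa , trans (cong (shift K) ea) e)

  injᴮ : ∀ {b b′} → B b → B b′ → index b ≡ index b′ → b ≡ b′
  injᴮ {b} {b′} Bb Bb′ e = begin
    b                                 ≡⟨ proj₁ (nth-position bs (∈bs Bb)) ⟨
    nth (position (code b) bs) bs     ≡⟨ cong (λ i → nth i bs)
                                             (zeros-injective (trans (sym (index-∈ (∈bs Bb))) (trans e (index-∈ (∈bs Bb′))))) ⟩
    nth (position (code b′) bs) bs    ≡⟨ proj₁ (nth-position bs (∈bs Bb′)) ⟩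
    b′                                ∎
    where open ≡-Reasoning

unique-enumeration : ∀ {B} → Finite B → Σ (List Str) λ bs → Unique bs × (∀ x → B x ⇔ x ∈ bs)
unique-enumeration (l , B⇔) =
  deduplicate (≡-dec Data.Bool._≟_) l , deduplicate-! l ,
  λ x → mk⇔ (λ Bx → ∈-deduplicate⁺ _ (Equivalence.to (B⇔ x) Bx))
            (λ x∈ → Equivalence.from (B⇔ x) (∈-deduplicate⁻ _ l x∈))

⊕-finite : ∀ {A B} → Finite A → Finite B → Finite (A ⊕ B)
⊕-finite {A} {B} (la , A⇔) (lb , B⇔) = map (_∷ʳ false) la ++ map (_∷ʳ true) lb , λ x → mk⇔ to (from x)
  where
  to : ∀ {x} → (A ⊕ B) x → x ∈ map (_∷ʳ false) la ++ map (_∷ʳ true) lb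
  to (inl Ax) = ∈-++⁺ˡ (∈-map⁺ (_∷ʳ false) (Equivalence.to (A⇔ _) Ax))
  to (inr Bx) = ∈-++⁺ʳ (map (_∷ʳ false) la) (∈-map⁺ (_∷ʳ true) (Equivalence.to (B⇔ _) Bx))
  from : ∀ x → x ∈ map (_∷ʳ false) la ++ map (_∷ʳ true) lb → (A ⊕ B) x
  from x x∈ with ∈-++⁻ (map (_∷ʳ false) la) x∈
  ... | inj₁ x∈ˡ with ∈-map⁻ (_∷ʳ false) x∈ˡ
  ...   | a , a∈ , refl = inl (Equivalence.from (A⇔ a) a∈)
  from x x∈ | inj₂ x∈ʳ with ∈-map⁻ (_∷ʳ true) x∈ʳ
  ...   | b , b∈ , refl = inr (Equivalence.from (B⇔ b) b∈)

joint-compressible : ∀ {A B hA hB} → PolyComputable hA → PolyComputable hB → JointCompression A B hA hB →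
                     PCompressible (A ⊕ B)
joint-compressible pA pB j =
  dispatch _ _ , PolyComputable⇒PolyTime (join-computable pA pB) , JointCompression⇒IsCompressionFunction j

⊕-compressible : ∀ {A B} → PCompressible A → PCompressible B → PCompressible (A ⊕ B)
⊕-compressible (fA , ptA , cA) (fB , ptB , cB) =
  joint-compressible (recode-computable ptA nothing (just false) 0) (recode-computable ptB (just true) (just true) 0)
                     (tagged-joint cA cB)

⊕-compressible-finite : ∀ {A B} → PCompressible A → Finite B → PCompressible (A ⊕ B)
⊕-compressible-finite (fA , ptA , cA) finB =
  let bs , unique , B⇔ = unique-enumeration finB in
  joint-compressible (recode-computable ptA nothing nothing (length bs)) (index-computable bs) (shifted-joint cA unique B⇔)

⊕-finite-compressible : ∀ {A B} → Finite A → PCompressible B → PCompressible (A ⊕ B)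
⊕-finite-compressible finA (fB , ptB , cB) =
  let as , unique , A⇔ = unique-enumeration finA in
  joint-compressible (index-computable as) (recode-computable ptB nothing nothing (length as))
                     (JointCompression-swap (shifted-joint cB unique A⇔))

theorem30 : (A B : Lang) → PCompressible′ A → PCompressible′ B → PCompressible′ (A ⊕ B)
theorem30 A B (inj₁ finA) (inj₁ finB) = inj₁ (⊕-finite finA finB)
theorem30 A B (inj₂ cA)   (inj₂ cB)   = inj₂ (⊕-compressible cA cB)
theorem30 A B (inj₂ cA)   (inj₁ finB) = inj₂ (⊕-compressible-finite cA finB)
theorem30 A B (inj₁ finA) (inj₂ cB)   = inj₂ (⊕-finite-compressible finA cB)
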